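{- For every integer $m\ge 39$ with $m\notin\{40,41,43,44,46,47,49,50,53,55,56,58,59,61,62,64,67,68,70,71,73,74,76,77,79,80,82,83,85,86,88,89,92,95,98,101,131\}$, there exists a $3$-way $(v,14,2)$ Steiner trade of volume $m$ (for some $v$).
   Context: For integers $k>t\ge1$, a $3$-way $(v,k,t)$ trade of volume $m$ consists of three pairwise disjoint collections $T_1,T_2,T_3$, each of $m$ blocks ($k$-subsets of a $v$-set $V$), such that every $t$-subset of $V$ is contained in the same number of blocks in each $T_i$. Its foundation $\mathrm{found}(T)$ is the set of points covered by the blocks. It is a Steiner trade if every $t$-subset of $\mathrm{found}(T)$ occurs in at most one block of each $T_i$. -}

module Defs where

open import Data.Nat using (ℕ; _≤_; _<_)
open import Data.Fin using (Fin)
open import Data.Fin.Subset using (Subset; _⊆_; ∣_∣; ⋃)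
open import Data.Fin.Subset.Properties using (_⊆?_)
open import Data.Vec using (Vec; lookup; toList)
open import Data.List using (List; length; filter; _++_)
open import Data.Product using (_×_)
open import Relation.Binary.PropositionalEquality using (_≡_; _≢_)

Collection : ℕ → ℕ → Set
Collection v m = Vec (Subset v) m

occ : ∀ {v m} → Subset v → Collection v m → ℕ
occ S T = length (filter (S ⊆?_) (toList T))

AllOfSize : ∀ {v m} → ℕ → Collection v m → Set
AllOfSize k T = ∀ i → ∣ lookup T i ∣ ≡ k

Disjoint : ∀ {v m} → Collection v m → Collection v m → Set
Disjoint T T' = ∀ i j → lookup T i ≢ lookup T' j

record ThreeWayTrade (v k t m : ℕ) (T₁ T₂ T₃ : Collection v m) : Set where
  field
    t≥1     : 1 ≤ t
    t<k     : t < k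
    size₁   : AllOfSize k T₁
    size₂   : AllOfSize k T₂
    size₃   : AllOfSize k T₃
    disj₁₂  : Disjoint T₁ T₂
    disj₁₃  : Disjoint T₁ T₃
    disj₂₃  : Disjoint T₂ T₃
    balance : ∀ (S : Subset v) → ∣ S ∣ ≡ t →
              (occ S T₁ ≡ occ S T₂) × (occ S T₂ ≡ occ S T₃)

found : ∀ {v m} → Collection v m → Collection v m → Collection v m → Subset v
found T₁ T₂ T₃ = ⋃ (toList T₁ ++ toList T₂ ++ toList T₃)

record ThreeWaySteinerTrade (v k t m : ℕ) (T₁ T₂ T₃ : Collection v m) : Set where
  field
    trade   : ThreeWayTrade v k t m T₁ T₂ T₃
    steiner : ∀ (S : Subset v) → ∣ S ∣ ≡ t → S ⊆ found T₁ T₂ T₃ →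
              (occ S T₁ ≤ 1) × (occ S T₂ ≤ 1) × (occ S T₃ ≤ 1)

excluded : List ℕ
excluded = 40 Data.List.∷ 41 Data.List.∷ 43 Data.List.∷ 44 Data.List.∷ 46 Data.List.∷ 47 Data.List.∷ 49 Data.List.∷ 50 Data.List.∷ 53 Data.List.∷ 55 Data.List.∷ 56 Data.List.∷ 58 Data.List.∷ 59 Data.List.∷ 61 Data.List.∷ 62 Data.List.∷ 64 Data.List.∷ 67 Data.List.∷ 68 Data.List.∷ 70 Data.List.∷ 71 Data.List.∷ 73 Data.List.∷ 74 Data.List.∷ 76 Data.List.∷ 77 Data.List.∷ 79 Data.List.∷ 80 Data.List.∷ 82 Data.List.∷ 83 Data.List.∷ 85 Data.List.∷ 86 Data.List.∷ 88 Data.List.∷ 89 Data.List.∷ 92 Data.List.∷ 95 Data.List.∷ 98 Data.List.∷ 101 Data.List.∷ 131 Data.List.∷ Data.List.[]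

module Submission where

-- For t = 2 all conditions on a 3-way Steiner trade concern pairs of points, so we work
-- with IncidenceTrade: three families of blocks given by characteristic functions whose
-- pair counts agree across the families and are at most one.  `realise` turns one into a
-- ThreeWaySteinerTrade, and the `union` of trades on disjoint point sets adds volumes.
-- The building blocks are nets (module Net): n parallel classes of lines
-- {(t , x) | x + h j t ≡ i} on r columns of ℤ_G, line (j , i) of family s extended by the
-- point at infinity σ s j.  For a difference matrix h and permutations σ s that never
-- agree (the cyclic shifts of ℤ_n, n ≥ 3) this is a trade of volume n·G with blocks of
-- size r + 1.  With r = 13: n = 3 and G = 13,…,25 give 39, 42, …, 75, unions with volume
-- 39 give all larger multiples of 3, and the nets of volume 52 and 65 (n = 4, 5, G = 13)
-- cover the other residue classes modulo 3 from 91 and 104 on; the smaller volumes of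
-- those classes are excluded (checked by computation).

open import Defs
open import Data.Nat using (ℕ; _≤_)
open import Data.List.Membership.Propositional using (_∈_)
open import Data.Product using (∃-syntax)
open import Relation.Nullary using (¬_)

open import Function using (_∘_)
open import Data.Nat using (zero; suc; _+_; _*_; _∸_; _%_; _/_; _<_; z≤n; s≤s; NonZero; _≤?_; _<?_)
open import Data.Nat.Properties
  using (+-assoc; +-comm; +-identityʳ; <⇒≤; *-identityʳ; *-zeroʳ; ≤-trans; ≤-antisym; ≤-reflexive;
         m≤n+m; <-≤-trans; ≮⇒≥; m+[n∸m]≡n; allUpTo?)
  renaming (_≟_ to _≟ℕ_; suc-injective to ℕ-suc-injective)
open import Data.Nat.DivMod
  using (m≡m%n+[m/n]*n; [m+kn]%n≡m%n; %-distribˡ-+; m%n%n≡m%n; m%n<n; m<n⇒m%n≡m;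
         result; _divMod_)
open import Data.Nat.Solver using (module +-*-Solver)
open import Data.Bool using (Bool; true; false; _∧_)
open import Data.Bool.Properties using (∧-comm)
open import Data.Fin using (Fin; zero; suc; toℕ; fromℕ<; _↑ˡ_; _↑ʳ_; splitAt; combine; remQuot)
open import Data.Fin.Patterns using (0F; 1F; 2F)
open import Data.Fin.Properties
  using (toℕ-fromℕ<; toℕ-injective; toℕ<n; 0≢1+n; splitAt-↑ˡ; splitAt-↑ʳ; splitAt⁻¹-↑ˡ;
         splitAt⁻¹-↑ʳ; remQuot-combine; combine-remQuot; all?)
  renaming (_≟_ to _≟ᶠ_; suc-injective to Fin-suc-injective)
open import Data.Fin.Subset using (Subset; _⊆_; ∣_∣) renaming (_∈_ to _∈ₛ_)
open import Data.Fin.Subset.Properties using (_⊆?_)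
open import Data.Vec using (Vec; []; _∷_; lookup; tabulate)
open import Data.Vec.Properties using (lookup∘tabulate; []=⇒lookup; lookup⇒[]=)
open import Data.List.Membership.Propositional using (_∉_)
open import Data.List.Membership.DecPropositional _≟ℕ_ using (_∈?_)
open import Data.Product using (Σ; _×_; _,_; proj₁; proj₂; uncurry)
open import Data.Sum using (_⊎_; inj₁; inj₂)
open import Relation.Nullary using (Dec; yes; no; does; contradiction)
open import Data.Empty using (⊥; ⊥-elim)
open import Relation.Nullary.Decidable using (True; toWitness; from-yes; dec-true; dec-false; ¬?; _→-dec_)
open import Relation.Binary.PropositionalEquality

∑ : ∀ {m} → (Fin m → ℕ) → ℕ
∑ {zero}  f = 0
∑ {suc m} f = f zero + ∑ (λ i → f (suc i))

∑-cong : ∀ {m} {f g : Fin m → ℕ} → (∀ i → f i ≡ g i) → ∑ f ≡ ∑ g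
∑-cong {zero}  f≗g = refl
∑-cong {suc m} f≗g = cong₂ _+_ (f≗g zero) (∑-cong (λ i → f≗g (suc i)))

∑-const : ∀ {m} {f : Fin m → ℕ} c → (∀ i → f i ≡ c) → ∑ f ≡ m * c
∑-const {zero}  c f≡c = refl
∑-const {suc m} c f≡c = cong₂ _+_ (f≡c zero) (∑-const c (λ i → f≡c (suc i)))

∑-split : ∀ a {b} (f : Fin (a + b) → ℕ) →
  ∑ f ≡ ∑ (λ i → f (i ↑ˡ b)) + ∑ (λ i → f (a ↑ʳ i))
∑-split zero    f = refl
∑-split (suc a) f =
  trans (cong (f zero +_) (∑-split a (λ i → f (suc i)))) (sym (+-assoc (f zero) _ _))

∑-combine : ∀ a b (f : Fin (a * b) → ℕ) → ∑ f ≡ ∑ {a} (λ i → ∑ {b} (λ j → f (combine i j)))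
∑-combine zero    b f = refl
∑-combine (suc a) b f =
  trans (∑-split b f) (cong (∑ (λ j → f (j ↑ˡ (a * b))) +_) (∑-combine a b (λ k → f (b ↑ʳ k))))

indicator : Bool → ℕ
indicator true  = 1
indicator false = 0

count : ∀ {m} → (Fin m → Bool) → ℕ
count f = ∑ (λ i → indicator (f i))

count-cong : ∀ {m} {f g : Fin m → Bool} → (∀ i → f i ≡ g i) → count f ≡ count g
count-cong f≗g = ∑-cong (λ i → cong indicator (f≗g i))

count-none : ∀ {m} {f : Fin m → Bool} → (∀ i → f i ≡ false) → count f ≡ 0
count-none {m} none = trans (∑-const 0 (λ i → cong indicator (none i))) (*-zeroʳ m)

count-witness : ∀ {m} (f : Fin m → Bool) e → f e ≡ true → 1 ≤ count f
count-witness f zero    fe rewrite fe = s≤s z≤n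
count-witness f (suc e) fe =
  ≤-trans (count-witness (λ i → f (suc i)) e fe) (m≤n+m _ (indicator (f zero)))

count-atMostOne : ∀ {m} (f : Fin m → Bool) →
  (∀ i j → f i ≡ true → f j ≡ true → i ≡ j) → count f ≤ 1
count-atMostOne {zero}  f unique = z≤n
count-atMostOne {suc m} f unique with f zero in f0
... | true  = ≤-reflexive (cong suc (count-none others))
  where
  others : ∀ i → f (suc i) ≡ false
  others i with f (suc i) in fi
  ... | false = refl
  ... | true  = contradiction (unique zero (suc i) f0 fi) 0≢1+n
... | false = count-atMostOne (λ i → f (suc i))
                (λ i j fi fj → Fin-suc-injective (unique (suc i) (suc j) fi fj))

count-unique : ∀ {m} (f : Fin m → Bool) e → f e ≡ true → (∀ i → f i ≡ true → i ≡ e) →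
  count f ≡ 1
count-unique f e fe only-e =
  ≤-antisym (count-atMostOne f (λ i j fi fj → trans (only-e i fi) (sym (only-e j fj))))
            (count-witness f e fe)

count≡0⇒none : ∀ {m} (f : Fin m → Bool) → count f ≡ 0 → ∀ i → f i ≡ false
count≡0⇒none {suc m} f c≡0 i with f zero in f0
count≡0⇒none {suc m} f ()  i       | true
count≡0⇒none {suc m} f c≡0 zero    | false = f0
count≡0⇒none {suc m} f c≡0 (suc i) | false = count≡0⇒none (λ j → f (suc j)) c≡0 i

count≡suc⇒witness : ∀ {m c} (f : Fin m → Bool) → count f ≡ suc c → ∃[ a ] f a ≡ true
count≡suc⇒witness {suc m} f c≡1+c with f zero in f0
... | true  = zero , f0
... | false with count≡suc⇒witness (λ j → f (suc j)) c≡1+c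
...   | a , fa = suc a , fa

count≡1⇒unique : ∀ {m} (f : Fin m → Bool) → count f ≡ 1 →
  ∃[ a ] (f a ≡ true × (∀ i → f i ≡ true → i ≡ a))
count≡1⇒unique {suc m} f c≡1 with f zero in f0
... | true = zero , f0 , only-zero
  where
  only-zero : ∀ i → f i ≡ true → i ≡ zero
  only-zero zero    _  = refl
  only-zero (suc i) fi =
    contradiction (trans (sym fi) (count≡0⇒none (λ j → f (suc j)) (ℕ-suc-injective c≡1) i)) λ ()
... | false with count≡1⇒unique (λ j → f (suc j)) c≡1
...   | a , fa , only-a = suc a , fa , only-suc-a
  where
  only-suc-a : ∀ i → f i ≡ true → i ≡ suc a
  only-suc-a zero    fi = contradiction (trans (sym fi) f0) λ ()
  only-suc-a (suc i) fi = cong suc (only-a i fi)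

count≡2⇒pair : ∀ {m} (f : Fin m → Bool) → count f ≡ 2 →
  ∃[ a ] ∃[ b ] (a ≢ b × f a ≡ true × f b ≡ true × (∀ i → f i ≡ true → i ≡ a ⊎ i ≡ b))
count≡2⇒pair {suc m} f c≡2 with f zero in f0
... | true with count≡1⇒unique (λ j → f (suc j)) (ℕ-suc-injective c≡2)
...   | b , fb , only-b = zero , suc b , 0≢1+n , f0 , fb , zero-or-b
  where
  zero-or-b : ∀ i → f i ≡ true → i ≡ zero ⊎ i ≡ suc b
  zero-or-b zero    _  = inj₁ refl
  zero-or-b (suc i) fi = inj₂ (cong suc (only-b i fi))
count≡2⇒pair {suc m} f c≡2 | false with count≡2⇒pair (λ j → f (suc j)) c≡2
...   | a , b , a≢b , fa , fb , a-or-b = suc a , suc b , a≢b ∘ Fin-suc-injective , fa , fb , suc-a-or-b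
  where
  suc-a-or-b : ∀ i → f i ≡ true → i ≡ suc a ⊎ i ≡ suc b
  suc-a-or-b zero    fi = contradiction (trans (sym fi) f0) λ ()
  suc-a-or-b (suc i) fi with a-or-b i fi
  ... | inj₁ i≡a = inj₁ (cong suc i≡a)
  ... | inj₂ i≡b = inj₂ (cong suc i≡b)

does-true : ∀ {P : Set} (P? : Dec P) → does P? ≡ true → P
does-true (yes p) _ = p

does-≡ : ∀ {P : Set} (P? : Dec P) b → (b ≡ true → P) → (P → b ≡ true) → does P? ≡ b
does-≡ P? true  to from = dec-true P? (to refl)
does-≡ P? false to from = dec-false P? (λ p → contradiction (from p) λ ())

∧-true : ∀ {x y} → x ∧ y ≡ true → x ≡ true × y ≡ true
∧-true {true} {true} _ = refl , refl

∧-intro : ∀ {x y} → x ≡ true → y ≡ true → x ∧ y ≡ true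
∧-intro refl refl = refl

differs : ∀ {x y} → x ≡ true → y ≡ false → x ≢ y
differs refl refl ()

data SplitView (a b : ℕ) : Fin (a + b) → Set where
  left  : ∀ (i : Fin a) → SplitView a b (i ↑ˡ b)
  right : ∀ (i : Fin b) → SplitView a b (a ↑ʳ i)

splitView : ∀ a b i → SplitView a b i
splitView a b i with splitAt a i in eq
... | inj₁ j = subst (SplitView a b) (splitAt⁻¹-↑ˡ eq) (left j)
... | inj₂ j = subst (SplitView a b) (splitAt⁻¹-↑ʳ eq) (right j)

data CombineView (a b : ℕ) : Fin (a * b) → Set where
  pair : ∀ (i : Fin a) (j : Fin b) → CombineView a b (combine i j)

combineView : ∀ a b k → CombineView a b k
combineView a b k = subst (CombineView a b) (combine-remQuot {a} b k) (pair _ _)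

pairCount : ∀ {v m} → (Fin m → Fin v → Bool) → Fin v → Fin v → ℕ
pairCount B a b = count (λ i → B i a ∧ B i b)

pairCount-sym : ∀ {v m} (B : Fin m → Fin v → Bool) a b → pairCount B a b ≡ pairCount B b a
pairCount-sym B a b = count-cong (λ i → ∧-comm (B i a) (B i b))

-- A 3-way Steiner trade with t = 2, blocks of size k and volume m on Fin v, described by
-- incidence functions; for t = 2 balance and the Steiner property concern point pairs.
record IncidenceTrade (v k m : ℕ) : Set where
  field
    block     : Fin 3 → Fin m → Fin v → Bool
    blockSize : ∀ s i → count (block s i) ≡ k
    distinct  : ∀ s s' → s ≢ s' → ∀ i i' → ∃[ p ] block s i p ≢ block s' i' p
    balanced  : ∀ s s' a b → a ≢ b → pairCount (block s) a b ≡ pairCount (block s') a b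
    steiner   : ∀ s a b → a ≢ b → pairCount (block s) a b ≤ 1

collection : ∀ {v m} → (Fin m → Fin v → Bool) → Collection v m
collection B = tabulate (λ i → tabulate (B i))

lookup-collection : ∀ {v m} (B : Fin m → Fin v → Bool) i → lookup (collection B) i ≡ tabulate (B i)
lookup-collection B i = lookup∘tabulate (λ k → tabulate (B k)) i

∣∣≡count : ∀ {v} (S : Subset v) → ∣ S ∣ ≡ count (lookup S)
∣∣≡count []          = refl
∣∣≡count (true ∷ S)  = cong suc (∣∣≡count S)
∣∣≡count (false ∷ S) = ∣∣≡count S

∣tabulate∣ : ∀ {v} (f : Fin v → Bool) → ∣ tabulate f ∣ ≡ count f
∣tabulate∣ f = trans (∣∣≡count (tabulate f)) (count-cong (lookup∘tabulate f))

occ≡count : ∀ {v m} (S : Subset v) (T : Collection v m) →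
  occ S T ≡ count (λ i → does (S ⊆? lookup T i))
occ≡count S []      = refl
occ≡count S (B ∷ T) with does (S ⊆? B)
... | true  = cong suc (occ≡count S T)
... | false = occ≡count S T

occ-pair : ∀ {v} (S : Subset v) → ∣ S ∣ ≡ 2 →
  ∃[ a ] ∃[ b ] (a ≢ b × (∀ {m} (B : Fin m → Fin v → Bool) → occ S (collection B) ≡ pairCount B a b))
occ-pair S ∣S∣≡2 with count≡2⇒pair (lookup S) (trans (sym (∣∣≡count S)) ∣S∣≡2)
... | a , b , a≢b , a∈S , b∈S , only-a-b =
  a , b , a≢b , λ B → trans (occ≡count S (collection B)) (count-cong (contains B))
  where
  contains : ∀ {m} (B : Fin m → Fin _ → Bool) i → does (S ⊆? lookup (collection B) i) ≡ B i a ∧ B i b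
  contains B i rewrite lookup-collection B i = does-≡ (S ⊆? tabulate (B i)) _ to from
    where
    on-block : ∀ x → B i x ≡ true → x ∈ₛ tabulate (B i)
    on-block x Bix = lookup⇒[]= x _ (trans (lookup∘tabulate (B i) x) Bix)
    from-block : ∀ x → x ∈ₛ tabulate (B i) → B i x ≡ true
    from-block x x∈ = trans (sym (lookup∘tabulate (B i) x)) ([]=⇒lookup x∈)
    to : B i a ∧ B i b ≡ true → S ⊆ tabulate (B i)
    to both {x} x∈S with only-a-b x ([]=⇒lookup x∈S)
    ... | inj₁ refl = on-block x (proj₁ (∧-true both))
    ... | inj₂ refl = on-block x (proj₂ (∧-true {B i a} both))
    from : S ⊆ tabulate (B i) → B i a ∧ B i b ≡ true
    from S⊆ = ∧-intro (from-block a (S⊆ (lookup⇒[]= a S a∈S))) (from-block b (S⊆ (lookup⇒[]= b S b∈S)))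

module _ {v k m} (T : IncidenceTrade v k m) where
  open IncidenceTrade T

  family : Fin 3 → Collection v m
  family s = collection (block s)

  family-size : ∀ s → AllOfSize k (family s)
  family-size s i = trans (cong ∣_∣ (lookup-collection (block s) i))
                          (trans (∣tabulate∣ (block s i)) (blockSize s i))

  family-disjoint : ∀ s s' → s ≢ s' → Disjoint (family s) (family s')
  family-disjoint s s' s≢s' i i' same with distinct s s' s≢s' i i'
  ... | p , differ = differ (begin
      block s i p                         ≡⟨ lookup∘tabulate (block s i) p ⟨
      lookup (tabulate (block s i)) p     ≡⟨ cong (λ B → lookup B p) same-tabulate ⟩
      lookup (tabulate (block s' i')) p   ≡⟨ lookup∘tabulate (block s' i') p ⟩
      block s' i' p                       ∎)
    where
    open ≡-Reasoning
    same-tabulate : tabulate (block s i) ≡ tabulate (block s' i')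
    same-tabulate = trans (sym (lookup-collection (block s) i))
                          (trans same (lookup-collection (block s') i'))

  family-balanced : ∀ s s' S → ∣ S ∣ ≡ 2 → occ S (family s) ≡ occ S (family s')
  family-balanced s s' S ∣S∣≡2 with occ-pair S ∣S∣≡2
  ... | a , b , a≢b , occ≡ = trans (occ≡ (block s)) (trans (balanced s s' a b a≢b) (sym (occ≡ (block s'))))

  family-steiner : ∀ s S → ∣ S ∣ ≡ 2 → occ S (family s) ≤ 1
  family-steiner s S ∣S∣≡2 with occ-pair S ∣S∣≡2
  ... | a , b , a≢b , occ≡ = ≤-trans (≤-reflexive (occ≡ (block s))) (steiner s a b a≢b)

  realise : 2 < k → ∃[ T₁ ] ∃[ T₂ ] ∃[ T₃ ] ThreeWaySteinerTrade v k 2 m T₁ T₂ T₃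
  realise 2<k = family 0F , family 1F , family 2F , record
    { trade = record
      { t≥1 = s≤s z≤n ; t<k = 2<k
      ; size₁ = family-size 0F ; size₂ = family-size 1F ; size₃ = family-size 2F
      ; disj₁₂ = family-disjoint 0F 1F (λ ())
      ; disj₁₃ = family-disjoint 0F 2F (λ ())
      ; disj₂₃ = family-disjoint 1F 2F (λ ())
      ; balance = λ S ∣S∣≡2 → family-balanced 0F 1F S ∣S∣≡2 , family-balanced 1F 2F S ∣S∣≡2 }
    ; steiner = λ S ∣S∣≡2 _ → family-steiner 0F S ∣S∣≡2 , family-steiner 1F S ∣S∣≡2 , family-steiner 2F S ∣S∣≡2 }

module Union {v₁ v₂ k m₁ m₂} (A : IncidenceTrade v₁ (suc k) m₁) (B : IncidenceTrade v₂ (suc k) m₂) where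
  private
    module A = IncidenceTrade A
    module B = IncidenceTrade B

  incidence : Fin 3 → Fin m₁ ⊎ Fin m₂ → Fin v₁ ⊎ Fin v₂ → Bool
  incidence s (inj₁ i) (inj₁ p) = A.block s i p
  incidence s (inj₂ i) (inj₂ p) = B.block s i p
  incidence s _        _        = false

  block : Fin 3 → Fin (m₁ + m₂) → Fin (v₁ + v₂) → Bool
  block s i p = incidence s (splitAt m₁ i) (splitAt v₁ p)

  block-AA : ∀ s i p → block s (i ↑ˡ m₂) (p ↑ˡ v₂) ≡ A.block s i p
  block-AA s i p = cong₂ (incidence s) (splitAt-↑ˡ m₁ i m₂) (splitAt-↑ˡ v₁ p v₂)

  block-BB : ∀ s i p → block s (m₁ ↑ʳ i) (v₁ ↑ʳ p) ≡ B.block s i p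
  block-BB s i p = cong₂ (incidence s) (splitAt-↑ʳ m₁ m₂ i) (splitAt-↑ʳ v₁ v₂ p)

  block-AB : ∀ s i p → block s (i ↑ˡ m₂) (v₁ ↑ʳ p) ≡ false
  block-AB s i p = cong₂ (incidence s) (splitAt-↑ˡ m₁ i m₂) (splitAt-↑ʳ v₁ v₂ p)

  block-BA : ∀ s i p → block s (m₁ ↑ʳ i) (p ↑ˡ v₂) ≡ false
  block-BA s i p = cong₂ (incidence s) (splitAt-↑ʳ m₁ m₂ i) (splitAt-↑ˡ v₁ p v₂)

  blockSize : ∀ s i → count (block s i) ≡ suc k
  blockSize s i with splitView m₁ m₂ i
  ... | left i₁  = trans (∑-split v₁ _) (trans
        (cong₂ _+_ (trans (count-cong (block-AA s i₁)) (A.blockSize s i₁)) (count-none (block-AB s i₁)))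
        (+-identityʳ _))
  ... | right i₂ = trans (∑-split v₁ _)
        (cong₂ _+_ (count-none (block-BA s i₂)) (trans (count-cong (block-BB s i₂)) (B.blockSize s i₂)))

  -- A block of A and a block of B differ at any point of the (nonempty) block of A.
  distinct-AB : ∀ s s' i₁ i₂ → ∃[ p ] block s (i₁ ↑ˡ m₂) p ≢ block s' (m₁ ↑ʳ i₂) p
  distinct-AB s s' i₁ i₂ with count≡suc⇒witness (A.block s i₁) (A.blockSize s i₁)
  ... | p , p∈A = p ↑ˡ v₂ , differs (trans (block-AA s i₁ p) p∈A) (block-BA s' i₂ p)

  distinct : ∀ s s' → s ≢ s' → ∀ i i' → ∃[ p ] block s i p ≢ block s' i' p
  distinct s s' s≢s' i i' with splitView m₁ m₂ i | splitView m₁ m₂ i'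
  ... | left i₁ | left i₁' with A.distinct s s' s≢s' i₁ i₁'
  ...   | p , differ = p ↑ˡ v₂ , λ same → differ (trans (sym (block-AA s i₁ p)) (trans same (block-AA s' i₁' p)))
  distinct s s' s≢s' i i' | right i₂ | right i₂' with B.distinct s s' s≢s' i₂ i₂'
  ...   | p , differ = v₁ ↑ʳ p , λ same → differ (trans (sym (block-BB s i₂ p)) (trans same (block-BB s' i₂' p)))
  distinct s s' s≢s' i i' | left i₁ | right i₂' = distinct-AB s s' i₁ i₂'
  distinct s s' s≢s' i i' | right i₂ | left i₁' with distinct-AB s' s i₁' i₂
  ...   | p , differ = p , differ ∘ sym

  pairCount-AA : ∀ s a b → pairCount (block s) (a ↑ˡ v₂) (b ↑ˡ v₂) ≡ pairCount (A.block s) a b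
  pairCount-AA s a b = trans (∑-split m₁ _) (trans
    (cong₂ _+_ (count-cong (λ i → cong₂ _∧_ (block-AA s i a) (block-AA s i b)))
               (count-none (λ i → cong (_∧ _) (block-BA s i a))))
    (+-identityʳ _))

  pairCount-BB : ∀ s a b → pairCount (block s) (v₁ ↑ʳ a) (v₁ ↑ʳ b) ≡ pairCount (B.block s) a b
  pairCount-BB s a b = trans (∑-split m₁ _)
    (cong₂ _+_ (count-none (λ i → cong (_∧ _) (block-AB s i a)))
               (count-cong (λ i → cong₂ _∧_ (block-BB s i a) (block-BB s i b))))

  pairCount-AB : ∀ s a b → pairCount (block s) (a ↑ˡ v₂) (v₁ ↑ʳ b) ≡ 0
  pairCount-AB s a b = trans (∑-split m₁ _)
    (cong₂ _+_ (count-none (λ i → trans (cong (block s (i ↑ˡ m₂) (a ↑ˡ v₂) ∧_) (block-AB s i b))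
                                        (∧-comm _ false)))
               (count-none (λ i → cong (_∧ _) (block-BA s i a))))

  balanced : ∀ s s' a b → a ≢ b → pairCount (block s) a b ≡ pairCount (block s') a b
  balanced s s' a b a≢b with splitView v₁ v₂ a | splitView v₁ v₂ b
  ... | left a₁  | left b₁  = trans (pairCount-AA s a₁ b₁)
        (trans (A.balanced s s' a₁ b₁ (a≢b ∘ cong (_↑ˡ v₂))) (sym (pairCount-AA s' a₁ b₁)))
  ... | right a₂ | right b₂ = trans (pairCount-BB s a₂ b₂)
        (trans (B.balanced s s' a₂ b₂ (a≢b ∘ cong (v₁ ↑ʳ_))) (sym (pairCount-BB s' a₂ b₂)))
  ... | left a₁  | right b₂ = trans (pairCount-AB s a₁ b₂) (sym (pairCount-AB s' a₁ b₂))
  ... | right a₂ | left b₁  = trans (pairCount-sym (block s) _ _)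
        (trans (pairCount-AB s b₁ a₂) (sym (trans (pairCount-sym (block s') _ _) (pairCount-AB s' b₁ a₂))))

  steiner : ∀ s a b → a ≢ b → pairCount (block s) a b ≤ 1
  steiner s a b a≢b with splitView v₁ v₂ a | splitView v₁ v₂ b
  ... | left a₁  | left b₁  = subst (_≤ 1) (sym (pairCount-AA s a₁ b₁)) (A.steiner s a₁ b₁ (a≢b ∘ cong (_↑ˡ v₂)))
  ... | right a₂ | right b₂ = subst (_≤ 1) (sym (pairCount-BB s a₂ b₂)) (B.steiner s a₂ b₂ (a≢b ∘ cong (v₁ ↑ʳ_)))
  ... | left a₁  | right b₂ = subst (_≤ 1) (sym (pairCount-AB s a₁ b₂)) z≤n
  ... | right a₂ | left b₁  = subst (_≤ 1) (sym (trans (pairCount-sym (block s) _ _) (pairCount-AB s b₁ a₂))) z≤n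

  union : IncidenceTrade (v₁ + v₂) (suc k) (m₁ + m₂)
  union = record { block = block ; blockSize = blockSize ; distinct = distinct
                 ; balanced = balanced ; steiner = steiner }

open Union using (union)

module Residues (G : ℕ) .{{_ : NonZero G}} where
  open ≡-Reasoning
  open +-*-Solver using (solve; _:+_; _:=_)

  shift : ℕ → Fin G → Fin G
  shift c x = fromℕ< (m%n<n (toℕ x + c) G)

  toℕ-shift : ∀ c x → toℕ (shift c x) ≡ (toℕ x + c) % G
  toℕ-shift c x = toℕ-fromℕ< (m%n<n (toℕ x + c) G)

  shift-≡ : ∀ {c c' x x'} → shift c x ≡ shift c' x' → (toℕ x + c) % G ≡ (toℕ x' + c') % G
  shift-≡ {c} {c'} {x} {x'} eq = trans (sym (toℕ-shift c x)) (trans (cong toℕ eq) (toℕ-shift c' x'))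

  toℕ-% : ∀ (x : Fin G) → toℕ x % G ≡ toℕ x
  toℕ-% x = m<n⇒m%n≡m (toℕ<n x)

  %-cong-+ : ∀ {a b} c → a % G ≡ b % G → (a + c) % G ≡ (b + c) % G
  %-cong-+ {a} {b} c a≡b = begin
    (a + c) % G           ≡⟨ %-distribˡ-+ a c G ⟩
    (a % G + c % G) % G   ≡⟨ cong (λ z → (z + c % G) % G) a≡b ⟩
    (b % G + c % G) % G   ≡⟨ %-distribˡ-+ b c G ⟨
    (b + c) % G           ∎

  %-cong₂-+ : ∀ {a b a' b'} → a % G ≡ a' % G → b % G ≡ b' % G → (a + b) % G ≡ (a' + b') % G
  %-cong₂-+ {a} {b} {a'} {b'} a≡a' b≡b' = begin
    (a + b) % G             ≡⟨ %-distribˡ-+ a b G ⟩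
    (a % G + b % G) % G     ≡⟨ cong₂ (λ y z → (y + z) % G) a≡a' b≡b' ⟩
    (a' % G + b' % G) % G   ≡⟨ %-distribˡ-+ a' b' G ⟨
    (a' + b') % G           ∎

  negate : ℕ → ℕ
  negate c = G ∸ c % G

  +-negate : ∀ c → c + negate c ≡ suc (c / G) * G
  +-negate c = begin
    c + (G ∸ c % G)                       ≡⟨ cong (_+ (G ∸ c % G)) (m≡m%n+[m/n]*n c G) ⟩
    (c % G + c / G * G) + (G ∸ c % G)     ≡⟨ cong (_+ (G ∸ c % G)) (+-comm (c % G) (c / G * G)) ⟩
    (c / G * G + c % G) + (G ∸ c % G)     ≡⟨ +-assoc (c / G * G) (c % G) (G ∸ c % G) ⟩
    c / G * G + (c % G + (G ∸ c % G))     ≡⟨ cong (c / G * G +_) (m+[n∸m]≡n (<⇒≤ (m%n<n c G))) ⟩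
    c / G * G + G                         ≡⟨ +-comm (c / G * G) G ⟩
    suc (c / G) * G                       ∎

  +-negate-% : ∀ a c → (a + (c + negate c)) % G ≡ a % G
  +-negate-% a c = trans (cong (λ z → (a + z) % G) (+-negate c)) ([m+kn]%n≡m%n a (suc (c / G)) G)

  %-cancelʳ-+ : ∀ a b c → (a + c) % G ≡ (b + c) % G → a % G ≡ b % G
  %-cancelʳ-+ a b c eq = begin
    a % G                      ≡⟨ +-negate-% a c ⟨
    (a + (c + negate c)) % G   ≡⟨ cong (_% G) (+-assoc a c (negate c)) ⟨
    (a + c + negate c) % G     ≡⟨ %-cong-+ (negate c) eq ⟩
    (b + c + negate c) % G     ≡⟨ cong (_% G) (+-assoc b c (negate c)) ⟩
    (b + (c + negate c)) % G   ≡⟨ +-negate-% b c ⟩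
    b % G                      ∎

  shift-injective : ∀ c {x y} → shift c x ≡ shift c y → x ≡ y
  shift-injective c {x} {y} eq = toℕ-injective (begin
    toℕ x       ≡⟨ toℕ-% x ⟨
    toℕ x % G   ≡⟨ %-cancelʳ-+ (toℕ x) (toℕ y) c (shift-≡ {c} {c} {x} {y} eq) ⟩
    toℕ y % G   ≡⟨ toℕ-% y ⟩
    toℕ y       ∎)

  shift-negate : ∀ c x → shift c (shift (negate c) x) ≡ x
  shift-negate c x = toℕ-injective (begin
    toℕ (shift c (shift (negate c) x))   ≡⟨ toℕ-shift c _ ⟩
    (toℕ (shift (negate c) x) + c) % G   ≡⟨ %-cong-+ c (trans (cong (_% G) (toℕ-shift (negate c) x)) (m%n%n≡m%n _ G)) ⟩
    (toℕ x + negate c + c) % G           ≡⟨ cong (_% G) (+-assoc (toℕ x) (negate c) c) ⟩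
    (toℕ x + (negate c + c)) % G         ≡⟨ cong (λ z → (toℕ x + z) % G) (+-comm (negate c) c) ⟩
    (toℕ x + (c + negate c)) % G         ≡⟨ +-negate-% (toℕ x) c ⟩
    toℕ x % G                            ≡⟨ toℕ-% x ⟩
    toℕ x                                ∎)

  shift-apart : ∀ {a b} x → a < G → b < G → shift a x ≡ shift b x → a ≡ b
  shift-apart {a} {b} x a<G b<G eq = begin
    a                 ≡⟨ m<n⇒m%n≡m a<G ⟨
    a % G             ≡⟨ %-cancelʳ-+ a b (toℕ x) (begin
                           (a + toℕ x) % G   ≡⟨ cong (_% G) (+-comm a (toℕ x)) ⟩
                           (toℕ x + a) % G   ≡⟨ shift-≡ {a} {b} {x} {x} eq ⟩
                           (toℕ x + b) % G   ≡⟨ cong (_% G) (+-comm (toℕ x) b) ⟩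
                           (b + toℕ x) % G   ∎) ⟩
    b % G             ≡⟨ m<n⇒m%n≡m b<G ⟩
    b                 ∎

  difference-% : ∀ x x' a a' b b' →
    (x + a) % G ≡ (x' + a') % G → (x' + b') % G ≡ (x + b) % G → (a + b') % G ≡ (a' + b) % G
  difference-% x x' a a' b b' e₁ e₂ = %-cancelʳ-+ (a + b') (a' + b) (x + x') (begin
    (a + b' + (x + x')) % G
      ≡⟨ cong (_% G) (solve 4 (λ x x' a b' → a :+ b' :+ (x :+ x') := (x :+ a) :+ (x' :+ b')) refl x x' a b') ⟩
    ((x + a) + (x' + b')) % G
      ≡⟨ %-cong₂-+ e₁ e₂ ⟩
    ((x' + a') + (x + b)) % G
      ≡⟨ cong (_% G) (solve 4 (λ x x' a' b → (x' :+ a') :+ (x :+ b) := a' :+ b :+ (x :+ x')) refl x x' a' b) ⟩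
    (a' + b + (x + x')) % G ∎)

-- h is a difference matrix modulo G: for distinct rows j, j' the differences h j t − h j' t
-- are pairwise distinct modulo G (stated without subtraction).
DifferenceMatrix : ∀ {n r} (G : ℕ) .{{_ : NonZero G}} → (Fin n → Fin r → ℕ) → Set
DifferenceMatrix G h =
  ∀ j j' t t' → j ≢ j' → t ≢ t' → (h j t + h j' t') % G ≢ (h j t' + h j' t) % G

-- Affine points (t , x) ∈ Fin r × ℤ_G (column t); line i of class j is
-- {(t , x) | x + h j t ≡ i}; block (j , i) of family s is that line together with the
-- point at infinity σ s j.
module Net (n r G : ℕ) .{{_ : NonZero G}}
  (h : Fin n → Fin r → ℕ) (difference : DifferenceMatrix G h)
  (t₀ t₁ : Fin r) (t₀≢t₁ : t₀ ≢ t₁)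
  (σ : Fin 3 → Fin n → Fin n)
  (σ-surjective : ∀ s c → ∃[ j ] σ s j ≡ c)
  (σ-injective : ∀ s j j' → σ s j ≡ σ s j' → j ≡ j')
  (σ-apart : ∀ s s' → s ≢ s' → ∀ j → σ s j ≢ σ s' j)
  where
  open Residues G
  open ≡-Reasoning

  onLine : Fin n → Fin G → Fin r × Fin G → Bool
  onLine j i (t , x) = does (shift (h j t) x ≟ᶠ i)

  onLine-true : ∀ j i t x → onLine j i (t , x) ≡ true → shift (h j t) x ≡ i
  onLine-true j i t x = does-true (shift (h j t) x ≟ᶠ i)

  onLine-intro : ∀ j i t x → shift (h j t) x ≡ i → onLine j i (t , x) ≡ true
  onLine-intro j i t x = dec-true (shift (h j t) x ≟ᶠ i)

  meet : Fin n → Fin G → Fin r → Fin G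
  meet j i t = shift (negate (h j t)) i

  column-meet : ∀ j i t → count (λ x → onLine j i (t , x)) ≡ 1
  column-meet j i t = count-unique _ (meet j i t) (onLine-intro j i t _ (shift-negate (h j t) i))
    (λ x on → shift-injective (h j t) (trans (onLine-true j i t x on) (sym (shift-negate (h j t) i))))

  -- Lines of different classes share at most one point: this is the difference property.
  lines-meet-once : ∀ {j j' i i' t t' x x'} → j ≢ j' → (t , x) ≢ (t' , x') →
    shift (h j t) x ≡ i → shift (h j t') x' ≡ i → shift (h j' t) x ≡ i' → shift (h j' t') x' ≡ i' → ⊥
  lines-meet-once {j} {j'} {t = t} {t'} {x} {x'} j≢j' p≢p' e₁ e₂ e₃ e₄ with t ≟ᶠ t'
  ... | yes refl = p≢p' (cong (t ,_) (shift-injective (h j t) (trans e₁ (sym e₂))))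
  ... | no t≢t'  = difference j j' t t' j≢j' t≢t'
        (difference-% (toℕ x) (toℕ x') (h j t) (h j t') (h j' t) (h j' t')
          (shift-≡ {h j t} {h j t'} {x} {x'} (trans e₁ (sym e₂)))
          (shift-≡ {h j' t'} {h j' t} {x'} {x} (trans e₄ (sym e₃))))

  -- Points: the n points at infinity, then the affine points.
  incidence : Fin 3 → Fin n × Fin G → Fin n ⊎ Fin (r * G) → Bool
  incidence s (j , i) (inj₁ c) = does (σ s j ≟ᶠ c)
  incidence s (j , i) (inj₂ q) = onLine j i (remQuot {r} G q)

  block : Fin 3 → Fin (n * G) → Fin (n + r * G) → Bool
  block s k p = incidence s (remQuot {n} G k) (splitAt n p)

  ∞ : Fin n → Fin (n + r * G)
  ∞ c = c ↑ˡ r * G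

  affine : Fin r → Fin G → Fin (n + r * G)
  affine t x = n ↑ʳ combine t x

  data NetPoint : Fin (n + r * G) → Set where
    at-∞ : ∀ c → NetPoint (∞ c)
    at   : ∀ t x → NetPoint (affine t x)

  netPoint : ∀ p → NetPoint p
  netPoint p with splitView n (r * G) p
  ... | left c = at-∞ c
  ... | right q with combineView r G q
  ...   | pair t x = at t x

  line : Fin (n * G) → Fin r × Fin G → Bool
  line k = onLine (proj₁ (remQuot {n} G k)) (proj₂ (remQuot {n} G k))

  block-line : ∀ s k t x → block s k (affine t x) ≡ line k (t , x)
  block-line s k t x = trans (cong (incidence s (remQuot {n} G k)) (splitAt-↑ʳ n (r * G) (combine t x)))
                             (cong (line k) (remQuot-combine t x))

  line-combine : ∀ j i a → line (combine j i) a ≡ onLine j i a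
  line-combine j i a = cong (λ ji → onLine (proj₁ ji) (proj₂ ji) a) (remQuot-combine j i)

  block-affine : ∀ s j i t x → block s (combine j i) (affine t x) ≡ onLine j i (t , x)
  block-affine s j i t x = trans (block-line s (combine j i) t x) (line-combine j i (t , x))

  block-∞ : ∀ s j i c → block s (combine j i) (∞ c) ≡ does (σ s j ≟ᶠ c)
  block-∞ s j i c = cong₂ (incidence s) (remQuot-combine j i) (splitAt-↑ˡ n c (r * G))

  on-block : ∀ s j i t x → block s (combine j i) (affine t x) ≡ true → shift (h j t) x ≡ i
  on-block s j i t x on = onLine-true j i t x (trans (sym (block-affine s j i t x)) on)

  block-meet : ∀ s j i t → block s (combine j i) (affine t (meet j i t)) ≡ true
  block-meet s j i t = trans (block-affine s j i t _) (onLine-intro j i t _ (shift-negate (h j t) i))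

  blockSize : ∀ s k → count (block s k) ≡ suc r
  blockSize s k with combineView n G k
  ... | pair j i = trans (∑-split n _) (cong₂ _+_ infinite-part affine-part)
    where
    infinite-part : count (λ c → block s (combine j i) (∞ c)) ≡ 1
    infinite-part = count-unique _ (σ s j) (trans (block-∞ s j i _) (dec-true (σ s j ≟ᶠ σ s j) refl))
      (λ c on → sym (does-true (σ s j ≟ᶠ c) (trans (sym (block-∞ s j i c)) on)))
    affine-part : count (λ q → block s (combine j i) (n ↑ʳ q)) ≡ r
    affine-part = begin
      count (λ q → block s (combine j i) (n ↑ʳ q))
        ≡⟨ ∑-combine r G _ ⟩
      ∑ (λ t → count (λ x → block s (combine j i) (affine t x)))
        ≡⟨ ∑-const 1 (λ t → trans (count-cong (block-affine s j i t)) (column-meet j i t)) ⟩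
      r * 1
        ≡⟨ *-identityʳ r ⟩
      r ∎

  -- Blocks of different families differ: at infinity if they come from the same class,
  -- otherwise at one of the two points of the first line in columns t₀ and t₁.
  distinct : ∀ s s' → s ≢ s' → ∀ k k' → ∃[ p ] block s k p ≢ block s' k' p
  distinct s s' s≢s' k k' with combineView n G k | combineView n G k'
  ... | pair j i | pair j' i' with j ≟ᶠ j'
  ...   | yes refl = ∞ (σ s j) , differs (trans (block-∞ s j i _) (dec-true (σ s j ≟ᶠ σ s j) refl))
                       (trans (block-∞ s' j i' _) (dec-false (σ s' j ≟ᶠ σ s j) (σ-apart s' s (s≢s' ∘ sym) j)))
  ...   | no j≢j' with block s' (combine j' i') (affine t₀ (meet j i t₀)) in on₀
                     | block s' (combine j' i') (affine t₁ (meet j i t₁)) in on₁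
  ...     | false | _     = affine t₀ (meet j i t₀) , differs (block-meet s j i t₀) on₀
  ...     | true  | false = affine t₁ (meet j i t₁) , differs (block-meet s j i t₁) on₁
  ...     | true  | true  = ⊥-elim (lines-meet-once j≢j' (t₀≢t₁ ∘ cong proj₁)
                              (shift-negate (h j t₀) i) (shift-negate (h j t₁) i)
                              (on-block s' j' i' t₀ _ on₀) (on-block s' j' i' t₁ _ on₁))

  pairCount-∞∞ : ∀ s c c' → c ≢ c' → pairCount (block s) (∞ c) (∞ c') ≡ 0
  pairCount-∞∞ s c c' c≢c' = count-none not-both
    where
    not-both : ∀ k → block s k (∞ c) ∧ block s k (∞ c') ≡ false
    not-both k with combineView n G k
    ... | pair j i rewrite block-∞ s j i c | block-∞ s j i c' with σ s j ≟ᶠ c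
    ...   | no _     = refl
    ...   | yes refl = dec-false (σ s j ≟ᶠ c') c≢c'

  -- A point at infinity and an affine point lie in exactly one common block: the line
  -- through the affine point in the class that σ s sends to the point at infinity.
  pairCount-∞A : ∀ s c t x → pairCount (block s) (∞ c) (affine t x) ≡ 1
  pairCount-∞A s c t x with σ-surjective s c
  ... | j₀ , σj₀≡c = count-unique _ (combine j₀ (shift (h j₀ t) x))
        (trans (incident j₀ _) (∧-intro (dec-true (σ s j₀ ≟ᶠ c) σj₀≡c) (onLine-intro j₀ _ t x refl))) only
    where
    incident : ∀ j i → block s (combine j i) (∞ c) ∧ block s (combine j i) (affine t x)
                       ≡ does (σ s j ≟ᶠ c) ∧ onLine j i (t , x)
    incident j i = cong₂ _∧_ (block-∞ s j i c) (block-affine s j i t x)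
    only : ∀ k → block s k (∞ c) ∧ block s k (affine t x) ≡ true → k ≡ combine j₀ (shift (h j₀ t) x)
    only k both with combineView n G k
    ... | pair j i with ∧-true {does (σ s j ≟ᶠ c)} (trans (sym (incident j i)) both)
    ...   | σj≡c , on with σ-injective s j j₀ (trans (does-true (σ s j ≟ᶠ c) σj≡c) (sym σj₀≡c))
    ...     | refl = cong (combine j) (sym (onLine-true j i t x on))

  -- Two affine points lie on the same number of blocks in every family, namely on the
  -- number of lines through both, which is at most one.
  linesThrough : Fin r × Fin G → Fin r × Fin G → ℕ
  linesThrough a b = count (λ k → line k a ∧ line k b)

  pairCount-AA : ∀ s t x t' x' → pairCount (block s) (affine t x) (affine t' x') ≡ linesThrough (t , x) (t' , x')
  pairCount-AA s t x t' x' = count-cong (λ k → cong₂ _∧_ (block-line s k t x) (block-line s k t' x'))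

  linesThrough-≤1 : ∀ t x t' x' → (t , x) ≢ (t' , x') → linesThrough (t , x) (t' , x') ≤ 1
  linesThrough-≤1 t x t' x' a≢b = count-atMostOne _ same-line
    where
    on-both : ∀ j i → line (combine j i) (t , x) ∧ line (combine j i) (t' , x') ≡ true →
              shift (h j t) x ≡ i × shift (h j t') x' ≡ i
    on-both j i both with ∧-true {onLine j i (t , x)}
                            (trans (sym (cong₂ _∧_ (line-combine j i _) (line-combine j i _))) both)
    ... | on , on' = onLine-true j i t x on , onLine-true j i t' x' on'
    same-line : ∀ k k' → line k (t , x) ∧ line k (t' , x') ≡ true →
                line k' (t , x) ∧ line k' (t' , x') ≡ true → k ≡ k'
    same-line k k' both both' with combineView n G k | combineView n G k'
    ... | pair j i | pair j' i' with on-both j i both | on-both j' i' both' | j ≟ᶠ j'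
    ...   | e₁ , e₂ | e₃ , e₄ | yes refl = cong (combine j) (trans (sym e₁) e₃)
    ...   | e₁ , e₂ | e₃ , e₄ | no j≢j'  = ⊥-elim (lines-meet-once j≢j' a≢b e₁ e₂ e₃ e₄)

  balanced : ∀ s s' a b → a ≢ b → pairCount (block s) a b ≡ pairCount (block s') a b
  balanced s s' a b a≢b with netPoint a | netPoint b
  ... | at-∞ c | at-∞ c' = trans (pairCount-∞∞ s c c' (a≢b ∘ cong ∞)) (sym (pairCount-∞∞ s' c c' (a≢b ∘ cong ∞)))
  ... | at-∞ c | at t x  = trans (pairCount-∞A s c t x) (sym (pairCount-∞A s' c t x))
  ... | at t x | at-∞ c  = trans (pairCount-sym (block s) _ _)
        (trans (pairCount-∞A s c t x) (sym (trans (pairCount-sym (block s') _ _) (pairCount-∞A s' c t x))))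
  ... | at t x | at t' x' = trans (pairCount-AA s t x t' x') (sym (pairCount-AA s' t x t' x'))

  steiner : ∀ s a b → a ≢ b → pairCount (block s) a b ≤ 1
  steiner s a b a≢b with netPoint a | netPoint b
  ... | at-∞ c | at-∞ c' = subst (_≤ 1) (sym (pairCount-∞∞ s c c' (a≢b ∘ cong ∞))) z≤n
  ... | at-∞ c | at t x  = ≤-reflexive (pairCount-∞A s c t x)
  ... | at t x | at-∞ c  = ≤-reflexive (trans (pairCount-sym (block s) _ _) (pairCount-∞A s c t x))
  ... | at t x | at t' x' = ≤-trans (≤-reflexive (pairCount-AA s t x t' x'))
        (linesThrough-≤1 t x t' x' (a≢b ∘ cong (uncurry affine)))

  net : IncidenceTrade (n + r * G) (suc r) (n * G)
  net = record { block = block ; blockSize = blockSize ; distinct = distinct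
               ; balanced = balanced ; steiner = steiner }

differenceMatrix? : ∀ {n r} (G : ℕ) .{{_ : NonZero G}} (h : Fin n → Fin r → ℕ) → Dec (DifferenceMatrix G h)
differenceMatrix? G h = all? λ j → all? λ j' → all? λ t → all? λ t' →
  ¬? (j ≟ᶠ j') →-dec (¬? (t ≟ᶠ t') →-dec ¬? ((h j t + h j' t') % G ≟ℕ (h j t' + h j' t) % G))

cyclicNet : ∀ n G .{{_ : NonZero n}} .{{_ : NonZero G}} (h : Fin n → Fin 13 → ℕ) →
  {3≤n : True (3 ≤? n)} {h-difference : True (differenceMatrix? G h)} →
  IncidenceTrade (n + 13 * G) 14 (n * G)
cyclicNet n G h {3≤n} {h-difference} =
  Net.net n 13 G h (toWitness h-difference) 0F 1F (λ ()) cyclic surjective injective apart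
  where
  open Residues n
  cyclic : Fin 3 → Fin n → Fin n
  cyclic s = shift (toℕ s)
  surjective : ∀ s c → ∃[ j ] cyclic s j ≡ c
  surjective s c = shift (negate (toℕ s)) c , shift-negate (toℕ s) c
  injective : ∀ s j j' → cyclic s j ≡ cyclic s j' → j ≡ j'
  injective s j j' = shift-injective (toℕ s)
  apart : ∀ s s' → s ≢ s' → ∀ j → cyclic s j ≢ cyclic s' j
  apart s s' s≢s' j same = s≢s' (toℕ-injective
    (shift-apart j (<-≤-trans (toℕ<n s) (toWitness 3≤n)) (<-≤-trans (toℕ<n s') (toWitness 3≤n)) same))

-- Rows 0, t and φ t: a difference matrix modulo G when t ↦ φ t and t ↦ φ t − t are
-- injective modulo G.
threeRows : Vec ℕ 13 → Fin 3 → Fin 13 → ℕ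
threeRows φ 0F t = 0
threeRows φ 1F t = toℕ t
threeRows φ 2F t = lookup φ t

-- φ t = 2t serves every odd G ≥ 13; the other sequences serve the even G = 14, …, 24.
doubling φ₁₄ φ₁₆ φ₁₈ φ₂₂ : Vec ℕ 13
doubling = 0 ∷ 2 ∷ 4 ∷ 6 ∷ 8 ∷ 10 ∷ 12 ∷ 14 ∷ 16 ∷ 18 ∷ 20 ∷ 22 ∷ 24 ∷ []
φ₁₄ = 0 ∷ 2 ∷ 1 ∷ 5 ∷ 7 ∷ 10 ∷ 12 ∷ 11 ∷ 3 ∷ 6 ∷ 4 ∷ 9 ∷ 8 ∷ []
φ₁₆ = 0 ∷ 2 ∷ 1 ∷ 5 ∷ 7 ∷ 3 ∷ 10 ∷ 13 ∷ 15 ∷ 14 ∷ 4 ∷ 6 ∷ 8 ∷ []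
φ₁₈ = 0 ∷ 2 ∷ 1 ∷ 5 ∷ 7 ∷ 3 ∷ 10 ∷ 4 ∷ 13 ∷ 15 ∷ 17 ∷ 6 ∷ 8 ∷ []
φ₂₂ = 0 ∷ 2 ∷ 1 ∷ 5 ∷ 7 ∷ 3 ∷ 10 ∷ 4 ∷ 13 ∷ 15 ∷ 6 ∷ 18 ∷ 20 ∷ []

-- Rows j t = j t: a difference matrix modulo the prime 13.
linearRows : ∀ n → Fin n → Fin 13 → ℕ
linearRows n j t = toℕ j * toℕ t

Realisable : ℕ → Set
Realisable m = Σ ℕ λ v → IncidenceTrade v 14 m

_⊕_ : ∀ {a b} → Realisable a → Realisable b → Realisable (a + b)
(_ , A) ⊕ (_ , B) = _ , union A B

multipleOfThree : ∀ q → Realisable (39 + q * 3)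
multipleOfThree 0  = _ , cyclicNet 3 13 (threeRows doubling)
multipleOfThree 1  = _ , cyclicNet 3 14 (threeRows φ₁₄)
multipleOfThree 2  = _ , cyclicNet 3 15 (threeRows doubling)
multipleOfThree 3  = _ , cyclicNet 3 16 (threeRows φ₁₆)
multipleOfThree 4  = _ , cyclicNet 3 17 (threeRows doubling)
multipleOfThree 5  = _ , cyclicNet 3 18 (threeRows φ₁₈)
multipleOfThree 6  = _ , cyclicNet 3 19 (threeRows doubling)
multipleOfThree 7  = _ , cyclicNet 3 20 (threeRows φ₁₈)
multipleOfThree 8  = _ , cyclicNet 3 21 (threeRows doubling)
multipleOfThree 9  = _ , cyclicNet 3 22 (threeRows φ₂₂)
multipleOfThree 10 = _ , cyclicNet 3 23 (threeRows doubling)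
multipleOfThree 11 = _ , cyclicNet 3 24 (threeRows φ₂₂)
multipleOfThree 12 = _ , cyclicNet 3 25 (threeRows doubling)
multipleOfThree (suc (suc (suc (suc (suc (suc (suc (suc (suc (suc (suc (suc (suc q))))))))))))) =
  subst Realisable (solve 1 (λ q → con 39 :+ (con 39 :+ q :* con 3) := con 39 :+ (con 13 :+ q) :* con 3) refl q)
    (multipleOfThree 0 ⊕ multipleOfThree q)
  where open +-*-Solver

volume-split : ∀ r q₀ d → 39 + (r + q₀ * 3) + (39 + d * 3) ≡ 39 + (r + (13 + q₀ + d) * 3)
volume-split = solve 3 (λ r q₀ d → con 39 :+ (r :+ q₀ :* con 3) :+ (con 39 :+ d :* con 3)
                                   := con 39 :+ (r :+ (con 13 :+ q₀ :+ d) :* con 3)) refl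
  where open +-*-Solver

-- The residue class r modulo 3 is covered from a base volume b = 39 + (r + q₀ * 3) on,
-- provided every other volume of the class below b + 39 is excluded: above b + 39 the
-- volumes are b plus a multiple of three.
coverClass : ∀ r q₀ → Realisable (39 + (r + q₀ * 3)) →
  (∀ {q} → q < 13 + q₀ → q ≢ q₀ → 39 + (r + q * 3) ∈ excluded) →
  ∀ q → 39 + (r + q * 3) ∉ excluded → Realisable (39 + (r + q * 3))
coverClass r q₀ base below q q∉ with q <? 13 + q₀
... | yes q<13+q₀ with q ≟ℕ q₀
...   | yes refl = base
...   | no q≢q₀ = contradiction (below q<13+q₀ q≢q₀) q∉
coverClass r q₀ base below q q∉ | no q≮13+q₀ =
  subst (λ q → Realisable (39 + (r + q * 3))) (m+[n∸m]≡n (≮⇒≥ q≮13+q₀)) above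
  where
  d : ℕ
  d = q ∸ (13 + q₀)
  above : Realisable (39 + (r + (13 + q₀ + d) * 3))
  above = subst Realisable (volume-split r q₀ d) (base ⊕ multipleOfThree d)

excludedBelow : ∀ r q₀ → Dec (∀ {q} → q < 13 + q₀ → q ≢ q₀ → 39 + (r + q * 3) ∈ excluded)
excludedBelow r q₀ = allUpTo? (λ q → ¬? (q ≟ℕ q₀) →-dec (39 + (r + q * 3) ∈? excluded)) (13 + q₀)

realisable : ∀ d → 39 + d ∉ excluded → Realisable (39 + d)
realisable d d∉ with d divMod 3
... | result q 0F refl = multipleOfThree q
... | result q 1F refl = coverClass 1 4 (_ , cyclicNet 4 13 (linearRows 4)) (from-yes (excludedBelow 1 4)) q d∉
... | result q 2F refl = coverClass 2 8 (_ , cyclicNet 5 13 (linearRows 5)) (from-yes (excludedBelow 2 8)) q d∉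

realisable-≥39 : ∀ m → 39 ≤ m → m ∉ excluded → Realisable m
realisable-≥39 m 39≤m m∉excluded =
  subst Realisable m≡39+d (realisable (m ∸ 39) (m∉excluded ∘ subst (_∈ excluded) m≡39+d))
  where
  m≡39+d : 39 + (m ∸ 39) ≡ m
  m≡39+d = m+[n∸m]≡n 39≤m

mainTheorem18 : ∀ (m : ℕ) → 39 ≤ m → ¬ (m ∈ excluded) →
    ∃[ v ] ∃[ T₁ ] ∃[ T₂ ] ∃[ T₃ ] ThreeWaySteinerTrade v 14 2 m T₁ T₂ T₃
mainTheorem18 m 39≤m m∉excluded = proj₁ trade , realise (proj₂ trade) (s≤s (s≤s (s≤s z≤n)))
  where
  trade : Realisable m
  trade = realisable-≥39 m 39≤m m∉excluded
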